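{- Let $\pi$ be a set partition of $[n]$ avoiding $12/34$, and let $B=\{z_1<\cdots<z_a\}$ with $a\ge3$, $C=\{x_1<y_1\}$ and $D=\{x_2<y_2\}$ be blocks of $\pi$ (with $C\ne D$). Then (a) $\max(x_1,x_2)<\min(y_1,y_2)$, and (b) $x_1<z_2$ and $z_{a-1}<y_1$.
   Context: The standardization of a set partition of a finite set $S\subset\mathbb{Z}_{>0}$ replaces the $i$-th smallest element of $S$ by $i$. A set partition $\pi$ of $[n]$ contains $\tau\vdash[k]$ if for some $S\subseteq[n]$ the standardization of the restriction of $\pi$ to $S$ is $\tau$; otherwise it avoids $\tau$. $12/34$ is the partition of $[4]$ with blocks $\{1,2\},\{3,4\}$. -}

module Defs where

open import Data.Nat using (ℕ; zero; suc; _<_)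
open import Data.Fin using (Fin; toℕ)
open import Data.Product using (Σ; ∃; _×_)
open import Relation.Binary.PropositionalEquality using (_≡_)
open import Relation.Nullary using (¬_)
open import Function.Bundles using (_⇔_)

-- A set partition of [n] = {1,…,n} (elements represented by Fin n, the
-- i-th element i+1 represented by i, preserving order) is given by a
-- block labelling: two elements lie in the same block iff their labels agree.
SetPartition : ℕ → Set
SetPartition n = Fin n → ℕ

SameBlock : ∀ {n} → SetPartition n → Fin n → Fin n → Set
SameBlock π i j = π i ≡ π j

-- strictly increasing maps Fin k → Fin n (i.e. k-subsets S of [n] together
-- with their standardization order-isomorphism [k] ≅ S)
StrictlyIncreasing : ∀ {k n} → (Fin k → Fin n) → Set
StrictlyIncreasing {k} e = ∀ (i j : Fin k) → toℕ i < toℕ j → toℕ (e i) < toℕ (e j)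

Contains : ∀ {n k} → SetPartition n → SetPartition k → Set
Contains {n} {k} π τ =
  Σ (Fin k → Fin n) λ e → StrictlyIncreasing e ×
    (∀ (i j : Fin k) → SameBlock τ i j ⇔ SameBlock π (e i) (e j))

Avoids : ∀ {n k} → SetPartition n → SetPartition k → Set
Avoids π τ = ¬ Contains π τ

p12/34 : SetPartition 4
p12/34 Fin.zero = 0
p12/34 (Fin.suc Fin.zero) = 0
p12/34 (Fin.suc (Fin.suc Fin.zero)) = 1
p12/34 (Fin.suc (Fin.suc (Fin.suc Fin.zero))) = 1

IsBlockEnum : ∀ {n a} → SetPartition n → (Fin a → Fin n) → Set
IsBlockEnum {n} {a} π z =
  StrictlyIncreasing z ×
  (∀ (i j : Fin a) → SameBlock π (z i) (z j)) ×
  (∀ (u : Fin n) (i : Fin a) → SameBlock π u (z i) → ∃ λ j → u ≡ z j)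

IsPairBlock : ∀ {n} → SetPartition n → Fin n → Fin n → Set
IsPairBlock {n} π x y =
  toℕ x < toℕ y × SameBlock π x y ×
  (∀ (u : Fin n) → SameBlock π u x → (u ≡ x) Data.Sum.⊎ (u ≡ y))
  where import Data.Sum

-- Two arcs a < b and c < d of different blocks with b < c form the pattern 12/34, so in a
-- 12/34-avoiding partition every arc of one block starts before every arc of another block
-- ends. Applied to the arcs x₁y₁ and x₂y₂ this gives (a); applied to x₁y₁ against the first
-- arc z₁z₂ and the last arc z_{a-1}z_a of B it gives (b). That B is not the block {x₁, y₁}
-- is where a ≥ 3 enters: a pair cannot hold three distinct elements.
module Submission where

open import Defs
open import Data.Nat using (ℕ; suc; _≤_; _<_; _⊔_; _⊓_; s≤s; z≤n)
open import Data.Nat.Properties using (<-trans; <-irrefl; ⊔-lub; ⊓-glb)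
open import Data.Fin using (Fin; toℕ; zero; suc; fromℕ; inject₁)
  renaming (_<_ to _<ᶠ_)
open import Data.Fin.Properties using (<-cmp; pigeonhole; ≤̄⇒inject₁<)
  renaming (≤-refl to ≤-reflᶠ)
open import Data.Empty using (⊥-elim)
open import Data.Vec using (_∷_; []; lookup)
open import Data.Product using (_×_; _,_)
open import Data.Sum using (_⊎_; inj₁; inj₂; [_,_])
open import Function using (_∘_; const)
open import Function.Bundles using (mk⇔)
open import Relation.Nullary using (¬_)
open import Relation.Binary using (tri<; tri≈; tri>)
open import Relation.Binary.PropositionalEquality using (_≡_; _≢_; refl; sym; trans; cong)

StrictlyIncreasing-cons : ∀ {k n} {e : Fin (suc (suc k)) → Fin n} →
  e zero <ᶠ e (suc zero) → StrictlyIncreasing (e ∘ suc) → StrictlyIncreasing e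
StrictlyIncreasing-cons e₀<e₁ inc zero (suc zero) _ = e₀<e₁
StrictlyIncreasing-cons e₀<e₁ inc zero (suc (suc j)) _ = <-trans e₀<e₁ (inc zero (suc j) (s≤s z≤n))
StrictlyIncreasing-cons e₀<e₁ inc (suc i) (suc j) (s≤s i<j) = inc i j i<j

StrictlyIncreasing-singleton : ∀ {n} (e : Fin 1 → Fin n) → StrictlyIncreasing e
StrictlyIncreasing-singleton e zero zero ()

-- Pattern containment only compares labels, so a pattern occurs as soon as π ∘ e is a
-- relabelling of τ by a map that is injective on the labels of τ.
contains-relabelling : ∀ {n k} (π : SetPartition n) {τ : SetPartition k} (e : Fin k → Fin n)
  (f : ℕ → ℕ) → StrictlyIncreasing e → (∀ i → π (e i) ≡ f (τ i)) →
  (∀ i j → f (τ i) ≡ f (τ j) → τ i ≡ τ j) → Contains π τ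
contains-relabelling π e f inc relabel f-inj = e , inc , λ i j →
  mk⇔ (λ τi≡τj → trans (relabel i) (trans (cong f τi≡τj) (sym (relabel j))))
      (λ πei≡πej → f-inj i j (trans (sym (relabel i)) (trans πei≡πej (relabel j))))

twoValued : ℕ → ℕ → ℕ → ℕ
twoValued u v 0 = u
twoValued u v (suc _) = v

twoValued-injective : ∀ {u v a b} → u ≢ v → a ≤ 1 → b ≤ 1 →
  twoValued u v a ≡ twoValued u v b → a ≡ b
twoValued-injective u≢v z≤n z≤n _ = refl
twoValued-injective u≢v (s≤s z≤n) (s≤s z≤n) _ = refl
twoValued-injective u≢v z≤n (s≤s z≤n) u≡v = ⊥-elim (u≢v u≡v)
twoValued-injective u≢v (s≤s z≤n) z≤n v≡u = ⊥-elim (u≢v (sym v≡u))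

p12/34-≤1 : ∀ i → p12/34 i ≤ 1
p12/34-≤1 zero = z≤n
p12/34-≤1 (suc zero) = z≤n
p12/34-≤1 (suc (suc zero)) = s≤s z≤n
p12/34-≤1 (suc (suc (suc zero))) = s≤s z≤n

module _ {n : ℕ} {π : SetPartition n} where

  contains-12/34 : ∀ {a b c d} → a <ᶠ b → b <ᶠ c → c <ᶠ d →
    SameBlock π a b → SameBlock π c d → ¬ SameBlock π a c → Contains π p12/34
  contains-12/34 {a} {b} {c} {d} a<b b<c c<d a~b c~d a≁c =
    contains-relabelling π (lookup (a ∷ b ∷ c ∷ d ∷ [])) (twoValued (π a) (π c))
      increasing relabel
      (λ i j → twoValued-injective a≁c (p12/34-≤1 i) (p12/34-≤1 j))
    where
    increasing : StrictlyIncreasing (lookup (a ∷ b ∷ c ∷ d ∷ []))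
    increasing = StrictlyIncreasing-cons a<b (StrictlyIncreasing-cons b<c
      (StrictlyIncreasing-cons c<d (StrictlyIncreasing-singleton (lookup (d ∷ [])))))
    relabel : ∀ i → π (lookup (a ∷ b ∷ c ∷ d ∷ []) i) ≡ twoValued (π a) (π c) (p12/34 i)
    relabel zero = refl
    relabel (suc zero) = sym a~b
    relabel (suc (suc zero)) = refl
    relabel (suc (suc (suc zero))) = sym c~d

  arcs-overlap : Avoids π p12/34 → ∀ {a b c d} → a <ᶠ b → c <ᶠ d →
    SameBlock π a b → SameBlock π c d → ¬ SameBlock π a c → c <ᶠ b
  arcs-overlap avoids {b = b} {c = c} a<b c<d a~b c~d a≁c with <-cmp c b
  ... | tri< c<b _ _ = c<b
  ... | tri≈ _ refl _ = ⊥-elim (a≁c a~b)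
  ... | tri> _ _ b<c = ⊥-elim (avoids (contains-12/34 a<b b<c c<d a~b c~d a≁c))

module _ {A : Set} {x y : A} where

  side : ∀ {u} → u ≡ x ⊎ u ≡ y → Fin 2
  side = [ const zero , const (suc zero) ]

  side-injective : ∀ {u v} (p : u ≡ x ⊎ u ≡ y) (q : v ≡ x ⊎ v ≡ y) → side p ≡ side q → u ≡ v
  side-injective (inj₁ refl) (inj₁ refl) _ = refl
  side-injective (inj₂ refl) (inj₂ refl) _ = refl
  side-injective (inj₁ _) (inj₂ _) ()
  side-injective (inj₂ _) (inj₁ _) ()

no-increasing-into-pair : ∀ {k n} {e : Fin k → Fin n} {x y : Fin n} → 2 < k →
  StrictlyIncreasing e → ¬ (∀ i → e i ≡ x ⊎ e i ≡ y)
no-increasing-into-pair 2<k inc into with pigeonhole 2<k (side ∘ into)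
... | i , j , i<j , same = <-irrefl (cong toℕ (side-injective (into i) (into j) same)) (inc i j i<j)

pairBlock-≢-block : ∀ {n a} {π : SetPartition n} {x y : Fin n} {z : Fin a → Fin n} →
  2 < a → IsPairBlock π x y → IsBlockEnum π z → ∀ k → ¬ SameBlock π x (z k)
pairBlock-≢-block {z = z} 2<a (_ , _ , pair-closed) (inc , z~z , _) k x~zk =
  no-increasing-into-pair 2<a inc (λ i → pair-closed (z i) (trans (z~z i k) (sym x~zk)))

lemma4p8 : ∀ (n m : ℕ) (π : SetPartition n) → Avoids π p12/34 →
    (z : Fin (suc (suc (suc m))) → Fin n) → IsBlockEnum π z →
    (x₁ y₁ x₂ y₂ : Fin n) → IsPairBlock π x₁ y₁ → IsPairBlock π x₂ y₂ →
    ¬ SameBlock π x₁ x₂ →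
    ((toℕ x₁ ⊔ toℕ x₂) < (toℕ y₁ ⊓ toℕ y₂)) ×
    (toℕ x₁ < toℕ (z (suc zero)) × toℕ (z (inject₁ (fromℕ (suc m)))) < toℕ y₁)
lemma4p8 n m π avoids z B@(z-inc , z~z , _) x₁ y₁ x₂ y₂ C@(x₁<y₁ , x₁~y₁ , _) (x₂<y₂ , x₂~y₂ , _) x₁≁x₂ =
  ⊓-glb (⊔-lub x₁<y₁ x₂<y₁) (⊔-lub x₁<y₂ x₂<y₂) , x₁<z₂ , zₐ₋₁<y₁
  where
  penultimate last : Fin (suc (suc (suc m)))
  penultimate = inject₁ (fromℕ (suc m))
  last = fromℕ (suc (suc m))

  C≁B : ∀ k → ¬ SameBlock π x₁ (z k)
  C≁B = pairBlock-≢-block (s≤s (s≤s (s≤s z≤n))) C B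

  x₂<y₁ : x₂ <ᶠ y₁
  x₂<y₁ = arcs-overlap avoids x₁<y₁ x₂<y₂ x₁~y₁ x₂~y₂ x₁≁x₂
  x₁<y₂ : x₁ <ᶠ y₂
  x₁<y₂ = arcs-overlap avoids x₂<y₂ x₁<y₁ x₂~y₂ x₁~y₁ (x₁≁x₂ ∘ sym)
  x₁<z₂ : x₁ <ᶠ z (suc zero)
  x₁<z₂ = arcs-overlap avoids (z-inc zero (suc zero) (s≤s z≤n)) x₁<y₁
    (z~z zero (suc zero)) x₁~y₁ (C≁B zero ∘ sym)
  zₐ₋₁<y₁ : z penultimate <ᶠ y₁
  zₐ₋₁<y₁ = arcs-overlap avoids x₁<y₁ (z-inc penultimate last (≤̄⇒inject₁< ≤-reflᶠ))
    x₁~y₁ (z~z penultimate last) (C≁B penultimate)
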